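{- Let $G$ be a graph, let $X$ be a clique cutset of $G$, and let $u,v$ be vertices lying in two different connected components of $G-X$. Let $A,B\subseteq X$ be such that $u$ is close to $A$ with respect to $X$ and $v$ is close to $B$ with respect to $X$. Then for every $x\in X$, we have $x\in I(u,v)$ if and only if either $x\in A\cap B$, or $A\cap B=\emptyset$ and $x\in A\cup B$.
   Context: $I(u,v)$ denotes the set of vertices lying on some shortest path between $u$ and $v$, and $d$ denotes the graph distance. A clique cutset of $G$ is a clique $X$ such that $G-X$ is disconnected. For a clique $X$ of $G$, a vertex $y$ and a nonempty set $A\subseteq X$, $y$ is close to $A$ with respect to $X$ if there is an integer $d_y$ such that $d(y,x)=d_y$ for all $x\in A$ and $d(y,x)=d_y+1$ for all $x\in X\setminus A$. -}

module Defs where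

open import Data.Nat using (ℕ; zero; suc; _≤_)
open import Data.Fin using (Fin)
open import Data.Fin.Subset using (Subset; _∈_; _∉_; Nonempty)
open import Data.Bool using (Bool; true; false)
open import Data.Product using (Σ; ∃; _×_)
open import Relation.Binary.PropositionalEquality using (_≡_; _≢_)
open import Relation.Nullary using (¬_)

record Graph (n : ℕ) : Set where
  field
    adj    : Fin n → Fin n → Bool
    sym    : ∀ u v → adj u v ≡ adj v u
    irrefl : ∀ u → adj u u ≡ false

module _ {n : ℕ} (G : Graph n) where
  open Graph G

  Edge : Fin n → Fin n → Set
  Edge u v = adj u v ≡ true

  data Walk : Fin n → Fin n → ℕ → Set where
    []  : ∀ {u} → Walk u u zero
    _∷_ : ∀ {u w v k} → Edge u w → Walk w v k → Walk u v (suc k)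

  data OnWalk (z : Fin n) : ∀ {u v k} → Walk u v k → Set where
    here  : ∀ {v k} (w : Walk z v k) → OnWalk z w
    there : ∀ {u w v k} (e : Edge u w) {p : Walk w v k} →
            OnWalk z p → OnWalk z (e ∷ p)

  Dist : Fin n → Fin n → ℕ → Set
  Dist u v k = Walk u v k × (∀ m → Walk u v m → k ≤ m)

  InInterval : Fin n → Fin n → Fin n → Set
  InInterval u v x =
    Σ ℕ λ k → Dist u v k × Σ (Walk u v k) λ p → OnWalk x p

  Avoids : Subset n → ∀ {u v k} → Walk u v k → Set
  Avoids X p = ∀ z → OnWalk z p → z ∉ X

  Separated : Subset n → Fin n → Fin n → Set
  Separated X u v =
    u ∉ X × v ∉ X × (∀ k (p : Walk u v k) → ¬ Avoids X p)

  IsClique : Subset n → Set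
  IsClique X = ∀ x y → x ∈ X → y ∈ X → x ≢ y → Edge x y

  IsCliqueCutset : Subset n → Set
  IsCliqueCutset X = IsClique X × ∃ λ a → ∃ λ b → Separated X a b

  -- y is close to A with respect to X (A nonempty; A ⊆ X is assumed separately)
  CloseTo : Subset n → Fin n → Subset n → Set
  CloseTo X y A = Nonempty A × Σ ℕ λ d →
    (∀ x → x ∈ A → Dist y x d) × (∀ x → x ∈ X → x ∉ A → Dist y x (suc d))

module Submission where

-- Let d_u and d_v be the closeness radii of u (to A) and v (to B),
-- so a vertex z ∈ X is at distance d_u from u if z ∈ A and d_u + 1
-- otherwise, and likewise for v and B.  Since X separates u from v, every
-- u–v walk passes through some z ∈ X and splits there into a u–z and a
-- z–v walk; hence its length is at least d_u + d_v, at least d_u + d_v + 1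
-- when z ∉ A ∩ B, and at least d_u + d_v + 2 when z ∉ A ∪ B.  Conversely
-- these bounds are attained by concatenating shortest paths through z.
-- Consequently d(u,v) = d_u + d_v when A ∩ B ≠ ∅ (realised exactly through
-- A ∩ B) and d(u,v) = d_u + d_v + 1 otherwise (realised exactly through
-- A ∪ B), which is the claimed description of I(u,v) ∩ X.

open import Defs
open import Data.Nat using (ℕ; suc; _+_; _≤_; _<_)
open import Data.Nat.Properties using (≤-trans; n≤1+n; +-mono-≤; +-suc; <⇒≱)
open import Data.Fin using (Fin)
open import Data.Fin.Subset using (Subset; _∈_; _∉_; _⊆_; _∩_; _∪_; Empty)
open import Data.Fin.Subset.Properties using (_∈?_; x∈p∩q⁺; x∈p∩q⁻; x∈p∪q⁺; x∈p∪q⁻)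
open import Data.Product using (_×_; Σ; _,_; proj₁; proj₂)
open import Data.Sum using (_⊎_; inj₁; inj₂)
open import Data.Empty using (⊥-elim)
open import Relation.Nullary using (¬_; yes; no)
open import Relation.Binary.PropositionalEquality using (_≡_; refl; trans; cong; subst)
open import Function.Bundles using (_⇔_; mk⇔)

module Walks {n : ℕ} (G : Graph n) where
  open Graph G using () renaming (sym to adj-sym)

  WalkVia : Fin n → Fin n → Fin n → ℕ → Set
  WalkVia a b z k = Σ (Walk G a b k) (OnWalk G z)

  record Via (a b z : Fin n) (m : ℕ) : Set where
    constructor via
    field
      len₁ len₂ : ℕ
      first     : Walk G a z len₁
      second    : Walk G z b len₂
      total     : len₁ + len₂ ≡ m

  _++_ : ∀ {a b c k m} → Walk G a b k → Walk G b c m → Walk G a c (k + m)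
  []      ++ q = q
  (e ∷ p) ++ q = e ∷ (p ++ q)

  junction-on : ∀ {a b c k m} (p : Walk G a b k) (q : Walk G b c m) → OnWalk G b (p ++ q)
  junction-on []      q = here q
  junction-on (e ∷ p) q = there e (junction-on p q)

  join : ∀ {a b z m} → Via a b z m → WalkVia a b z m
  join (via _ _ p q refl) = p ++ q , junction-on p q

  split-at : ∀ {z a b k} {p : Walk G a b k} → OnWalk G z p → Via a b z k
  split-at {k = k} (here p) = via 0 k [] p refl
  split-at (there e z-on-p) with split-at z-on-p
  ... | via k₁ k₂ p q total = via (suc k₁) k₂ (e ∷ p) q (cong suc total)

  edge-sym : ∀ {a b} → Edge G a b → Edge G b a
  edge-sym {a} {b} e = trans (adj-sym b a) e

  _∷ʳ_ : ∀ {a b c k} → Walk G a b k → Edge G b c → Walk G a c (suc k)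
  []      ∷ʳ e = e ∷ []
  (f ∷ p) ∷ʳ e = f ∷ (p ∷ʳ e)

  reverse : ∀ {a b k} → Walk G a b k → Walk G b a k
  reverse []      = []
  reverse (e ∷ p) = reverse p ∷ʳ edge-sym e

  meets-or-avoids : (X : Subset n) → ∀ {a b k} (p : Walk G a b k) →
    Σ (Fin n) (λ z → OnWalk G z p × z ∈ X) ⊎ Avoids G X p
  meets-or-avoids X {a} p with a ∈? X
  ... | yes a∈X = inj₁ (a , here p , a∈X)
  meets-or-avoids X [] | no a∉X = inj₂ λ { z (here _) → a∉X }
  meets-or-avoids X (e ∷ p) | no a∉X with meets-or-avoids X p
  ... | inj₁ (z , z-on-p , z∈X) = inj₁ (z , there e z-on-p , z∈X)
  ... | inj₂ avoids = inj₂ λ { z (here _) → a∉X ; z (there _ z-on-p) → avoids z z-on-p }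

  crossing : ∀ {X a b m} → Separated G X a b → Walk G a b m →
    Σ (Fin n) λ z → z ∈ X × Via a b z m
  crossing {X} {m = m} (_ , _ , no-avoiding) p with meets-or-avoids X p
  ... | inj₁ (z , z-on-p , z∈X) = z , z∈X , split-at z-on-p
  ... | inj₂ avoids = ⊥-elim (no-avoiding m p avoids)

  interval-intro : ∀ {a b x k} → (∀ m → Walk G a b m → k ≤ m) →
    WalkVia a b x k → InInterval G a b x
  interval-intro {k = k} lower (p , x-on-p) = k , (p , lower) , p , x-on-p

module Closeness {n : ℕ} (G : Graph n) (X : Subset n) {y : Fin n} {A : Subset n}
                 (close : CloseTo G X y A) where

  -- The common distance d_y from y to the vertices of A.
  radius : ℕ
  radius = proj₁ (proj₂ close)

  path-in : ∀ {z} → z ∈ A → Walk G y z radius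
  path-in z∈A = proj₁ (proj₁ (proj₂ (proj₂ close)) _ z∈A)

  path-out : ∀ {z} → z ∈ X → z ∉ A → Walk G y z (suc radius)
  path-out z∈X z∉A = proj₁ (proj₂ (proj₂ (proj₂ close)) _ z∈X z∉A)

  lower-out : ∀ {z k} → z ∈ X → z ∉ A → Walk G y z k → suc radius ≤ k
  lower-out z∈X z∉A p = proj₂ (proj₂ (proj₂ (proj₂ close)) _ z∈X z∉A) _ p

  lower : ∀ {z k} → z ∈ X → Walk G y z k → radius ≤ k
  lower {z} z∈X p with z ∈? A
  ... | yes z∈A = proj₂ (proj₁ (proj₂ (proj₂ close)) z z∈A) _ p
  ... | no z∉A  = ≤-trans (n≤1+n radius) (lower-out z∈X z∉A p)

module Crossing {n : ℕ} (G : Graph n) (X : Subset n) {u v : Fin n} {A B : Subset n}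
                (A⊆X : A ⊆ X) (B⊆X : B ⊆ X) (closeU : CloseTo G X u A) (closeV : CloseTo G X v B) where
  open Walks G
  module U = Closeness G X closeU
  module V = Closeness G X closeV

  Described : Fin n → Set
  Described x = x ∈ A ∩ B ⊎ (Empty (A ∩ B) × x ∈ A ∪ B)

  -- d_u + d_v, the length of the shortest u–v walks through A ∩ B.
  base : ℕ
  base = U.radius + V.radius

  lower-via : ∀ {z m} → z ∈ X → Via u v z m → base ≤ m
  lower-via z∈X (via _ _ p q refl) = +-mono-≤ (U.lower z∈X p) (V.lower z∈X (reverse q))

  lower-via-strict : ∀ {z m} → z ∈ X → z ∉ A ∩ B → Via u v z m → suc base ≤ m
  lower-via-strict {z} z∈X z∉A∩B (via k₁ k₂ p q refl) with z ∈? A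
  ... | yes z∈A = subst (_≤ k₁ + k₂) (+-suc U.radius V.radius)
                    (+-mono-≤ (U.lower z∈X p) (V.lower-out z∈X z∉B (reverse q)))
    where
    z∉B : z ∉ B
    z∉B z∈B = z∉A∩B (x∈p∩q⁺ (z∈A , z∈B))
  ... | no z∉A  = +-mono-≤ (U.lower-out z∈X z∉A p) (V.lower z∈X (reverse q))

  lower-via-outside : ∀ {z m} → z ∈ X → z ∉ A → z ∉ B → Via u v z m → suc (suc base) ≤ m
  lower-via-outside z∈X z∉A z∉B (via k₁ k₂ p q refl) =
    subst (_≤ k₁ + k₂) (cong suc (+-suc U.radius V.radius))
      (+-mono-≤ (U.lower-out z∈X z∉A p) (V.lower-out z∈X z∉B (reverse q)))

  walk-via-both : ∀ {z} → z ∈ A ∩ B → WalkVia u v z base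
  walk-via-both z∈A∩B with x∈p∩q⁻ A B z∈A∩B
  ... | z∈A , z∈B = join (via _ _ (U.path-in z∈A) (reverse (V.path-in z∈B)) refl)

  walk-via-A : ∀ {z} → z ∈ A → z ∉ B → WalkVia u v z (suc base)
  walk-via-A z∈A z∉B = join (via _ _ (U.path-in z∈A)
    (reverse (V.path-out (A⊆X z∈A) z∉B)) (+-suc U.radius V.radius))

  walk-via-B : ∀ {z} → z ∉ A → z ∈ B → WalkVia u v z (suc base)
  walk-via-B z∉A z∈B = join (via _ _ (U.path-out (B⊆X z∈B) z∉A) (reverse (V.path-in z∈B)) refl)

  walk-via-union : ∀ {z} → Empty (A ∩ B) → z ∈ A ∪ B → WalkVia u v z (suc base)
  walk-via-union {z} disjoint z∈A∪B with x∈p∪q⁻ A B z∈A∪B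
  ... | inj₁ z∈A = walk-via-A z∈A λ z∈B → disjoint (z , x∈p∩q⁺ (z∈A , z∈B))
  ... | inj₂ z∈B = walk-via-B (λ z∈A → disjoint (z , x∈p∩q⁺ (z∈A , z∈B))) z∈B

  module _ (separated : Separated G X u v) where

    walks-long : ∀ m → Walk G u v m → base ≤ m
    walks-long m p with crossing separated p
    ... | z , z∈X , cut = lower-via z∈X cut

    walks-longer : Empty (A ∩ B) → ∀ m → Walk G u v m → suc base ≤ m
    walks-longer disjoint m p with crossing separated p
    ... | z , z∈X , cut = lower-via-strict z∈X (λ z∈A∩B → disjoint (z , z∈A∩B)) cut


    described⇒interval : ∀ {x} → Described x → InInterval G u v x
    described⇒interval (inj₁ x∈A∩B) =
      interval-intro walks-long (walk-via-both x∈A∩B)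
    described⇒interval (inj₂ (disjoint , x∈A∪B)) =
      interval-intro (walks-longer disjoint) (walk-via-union disjoint x∈A∪B)

  -- Every vertex of X on a shortest u–v walk is described by A and B;
  -- this direction uses only the attained walks, not the separation.
  interval⇒described : ∀ {x} → x ∈ X → InInterval G u v x → Described x
  interval⇒described {x} x∈X (k , (_ , shortest) , p , x-on-p) with x ∈? A ∩ B
  ... | yes x∈A∩B = inj₁ x∈A∩B
  ... | no x∉A∩B = inj₂ (disjoint , x∈A∪B)
    where
    x-cut : Via u v x k
    x-cut = split-at x-on-p

    not-shorter : ∀ {z m} → WalkVia u v z m → ¬ (m < k)
    not-shorter (q , _) m<k = <⇒≱ m<k (shortest _ q)

    -- a vertex of A ∩ B would give a walk of length d_u + d_v < k
    disjoint : Empty (A ∩ B)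
    disjoint (y , y∈A∩B) =
      not-shorter (walk-via-both y∈A∩B) (lower-via-strict x∈X x∉A∩B x-cut)

    -- otherwise k ≥ d_u + d_v + 2, beaten by a walk through a vertex of A
    x∈A∪B : x ∈ A ∪ B
    x∈A∪B with x ∈? A | x ∈? B | proj₁ closeU
    ... | yes x∈A | _       | _ = x∈p∪q⁺ (inj₁ x∈A)
    ... | no _    | yes x∈B | _ = x∈p∪q⁺ {p = A} (inj₂ x∈B)
    ... | no x∉A  | no x∉B  | a , a∈A =
      ⊥-elim (not-shorter (walk-via-A a∈A a∉B) (lower-via-outside x∈X x∉A x∉B x-cut))
      where
      a∉B : a ∉ B
      a∉B a∈B = disjoint (a , x∈p∩q⁺ (a∈A , a∈B))

-- Lemma 4.  The clique-cutset hypothesis is only used through the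
-- separation of u and v by X.
lemma4 : ∀ {n : ℕ} (G : Graph n) (X : Subset n) (u v : Fin n) (A B : Subset n) →
    IsCliqueCutset G X → Separated G X u v →
    A ⊆ X → B ⊆ X → CloseTo G X u A → CloseTo G X v B →
    ∀ x → x ∈ X →
    (InInterval G u v x ⇔ (x ∈ A ∩ B ⊎ (Empty (A ∩ B) × x ∈ A ∪ B)))
lemma4 G X u v A B _ separated A⊆X B⊆X closeU closeV x x∈X =
  mk⇔ (interval⇒described x∈X) (described⇒interval separated)
  where open Crossing G X A⊆X B⊆X closeU closeV
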